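{- For every positive integer $n$, the vertices of $\mathrm{BTP}(n)$ are exactly the TSSCPP boolean triangles of order $n$.
   Context: A TSSCPP boolean triangle of order $n$ is a triangular array $(b_{i,n-j})_{1\le j\le i\le n-1}$ (so $\binom{n}{2}$ entries) with entries in $\{0,1\}$ such that for all $1\le j<i\le n-1$, $$1+\sum_{k=j+1}^{i}b_{k,n-j-1}\ge\sum_{k=j}^{i}b_{k,n-j}.$$ $\mathrm{BTP}(n)$ is the convex hull in $\mathbb{R}^{\binom{n}{2}}$ (coordinates indexed by the positions $(i,n-j)$, $1\le j\le i\le n-1$) of all TSSCPP boolean triangles of order $n$.
   Formalization: The ambient space is ℚ^(n choose 2) rather than $\mathbb{R}^{\binom{n}{2}}$, so points have rational coordinates and the convex-combination coefficients defining $\mathrm{BTP}(n)$ and its vertices are rational. -}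

module Defs where

open import Data.Bool using (Bool; true; false; if_then_else_)
open import Data.Nat using (ℕ; suc; _+_; _∸_; _≤_; _<_; _≤?_)
import Data.Nat as ℕ
open import Data.List using (List; map; upTo; foldr)
open import Data.Product using (Σ; _×_; _,_; ∃)
open import Data.Rational using (ℚ; 0ℚ; 1ℚ) renaming (_+_ to _+ℚ_; _*_ to _*ℚ_; _-_ to _-ℚ_; _≤_ to _≤ℚ_; _<_ to _<ℚ_)
open import Relation.Nullary using (yes; no)
open import Relation.Binary.PropositionalEquality using (_≡_)

-- Positions (i , j) with 1 ≤ j ≤ i ≤ n-1 ; the pair (i , j) stands for the
-- paper's position (i , n-j), i.e. entry b_{i,n-j}.
Idx : ℕ → Set
Idx n = Σ ℕ λ i → Σ ℕ λ j → (1 ≤ j) × (j ≤ i) × (i ≤ n ∸ 1)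

Triangle : ℕ → Set
Triangle n = Idx n → Bool

bit : Bool → ℕ
bit true  = 1
bit false = 0

-- entry b_{i,n-j} as a natural number (0 outside the triangle; only used inside)
entry : (n : ℕ) → Triangle n → ℕ → ℕ → ℕ
entry n t i j with 1 ≤? j | j ≤? i | i ≤? n ∸ 1
... | yes p | yes q | yes r = bit (t (i , j , p , q , r))
... | _     | _     | _     = 0

sumRange : ℕ → ℕ → (ℕ → ℕ) → ℕ
sumRange a b f = foldr _+_ 0 (map (λ d → f (a + d)) (upTo (suc b ∸ a)))

-- TSSCPP condition: for all 1 ≤ j < i ≤ n-1,
--   1 + Σ_{k=j+1}^{i} b_{k,n-j-1} ≥ Σ_{k=j}^{i} b_{k,n-j}.
IsTSSCPP : (n : ℕ) → Triangle n → Set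
IsTSSCPP n t = ∀ (i j : ℕ) → 1 ≤ j → j < i → i ≤ n ∸ 1 →
  sumRange j i (λ k → entry n t k j) ≤ 1 + sumRange (suc j) i (λ k → entry n t k (suc j))

Point : ℕ → Set
Point n = Idx n → ℚ

bitℚ : Bool → ℚ
bitℚ b = if b then 1ℚ else 0ℚ

embed : (n : ℕ) → Triangle n → Point n
embed n t p = bitℚ (t p)

sumℚ : List ℚ → ℚ
sumℚ = foldr _+ℚ_ 0ℚ

InBTP : (n : ℕ) → Point n → Set
InBTP n x = Σ (List (ℚ × Triangle n)) λ L →
    (∀ {c t} → (c , t) ∈L L → (0ℚ ≤ℚ c) × IsTSSCPP n t)
  × (sumℚ (map (λ ct → Data.Product.proj₁ ct) L) ≡ 1ℚ)
  × (∀ p → x p ≡ sumℚ (map (λ ct → Data.Product.proj₁ ct *ℚ embed n (Data.Product.proj₂ ct) p) L))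
  where
    open import Data.List.Membership.Propositional using () renaming (_∈_ to _∈L_)
    import Data.Product

IsVertex : (n : ℕ) → Point n → Set
IsVertex n x = InBTP n x ×
  (∀ (y z : Point n) (c : ℚ) → InBTP n y → InBTP n z → 0ℚ <ℚ c → c <ℚ 1ℚ →
     (∀ p → x p ≡ (c *ℚ y p) +ℚ ((1ℚ -ℚ c) *ℚ z p)) →
     (∀ p → y p ≡ x p) × (∀ p → z p ≡ x p))

{-# OPTIONS --safe #-}
-- Nothing about TSSCPPs is needed beyond the fact that the triangles are 0/1 vectors.
-- Every point of the hull has coordinates in [0,1], and 0 or 1 is a proper convex
-- combination of two numbers of [0,1] only if both equal it; so each triangle is a
-- vertex. Conversely, write a vertex x as a convex combination of triangles and take
-- a term c t with c > 0: if c = 1 then x = t, and if c < 1 then x = c t + (1 - c) z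
-- with z the renormalised remaining combination, so extremality forces x = t.
module Submission where

open import Defs
open import Data.Product using (Σ; _×_; _,_; proj₁; proj₂)
open import Relation.Binary.PropositionalEquality using (_≡_; refl; sym; trans; cong; subst; subst₂; module ≡-Reasoning)
open import Relation.Binary.Definitions using (tri<; tri≈; tri>)
open import Data.Bool using (Bool; true; false)
open import Data.List using (List; []; _∷_; map)
open import Data.List.Relation.Unary.Any using (here; there)
open import Data.List.Membership.Propositional using (_∈_)
open import Data.List.Membership.Propositional.Properties using (∈-map⁻)
open import Data.Empty using (⊥-elim)

module _ where
  open import Data.Rational using (ℚ; 0ℚ; 1ℚ; _+_; _*_; _-_; -_; _≤_; _<_; 1/_; positive; nonNegative)
  open import Data.Rational.Properties
  open import Algebra.Properties.Group +-0-group using (x∙y⁻¹≈ε⇒x≈y)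
  open import Data.Rational.Solver using (module +-*-Solver)
  open +-*-Solver

  0≤p+q : ∀ {p q} → 0ℚ ≤ p → 0ℚ ≤ q → 0ℚ ≤ p + q
  0≤p+q {p} {q} 0≤p 0≤q = subst (_≤ p + q) (+-identityˡ 0ℚ) (+-mono-≤ 0≤p 0≤q)

  0≤p*q : ∀ {p q} → 0ℚ ≤ p → 0ℚ ≤ q → 0ℚ ≤ p * q
  0≤p*q {p} {q} 0≤p 0≤q = subst (_≤ p * q) (*-zeroʳ p) (*-monoˡ-≤-nonNeg p {{nonNegative 0≤p}} 0≤q)

  p≤q⇒0≤q-p : ∀ {p q} → p ≤ q → 0ℚ ≤ q - p
  p≤q⇒0≤q-p {p} {q} p≤q = subst (_≤ q - p) (+-inverseʳ p) (+-monoˡ-≤ (- p) p≤q)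

  p<q⇒0<q-p : ∀ {p q} → p < q → 0ℚ < q - p
  p<q⇒0<q-p {p} {q} p<q = subst (_< q - p) (+-inverseʳ p) (+-monoˡ-< (- p) p<q)

  p-q≡0⇒p≡q : ∀ {p q} → p - q ≡ 0ℚ → p ≡ q
  p-q≡0⇒p≡q {p} {q} = x∙y⁻¹≈ε⇒x≈y p q

  p+q≡0⇒p≡0 : ∀ {p q} → 0ℚ ≤ p → 0ℚ ≤ q → p + q ≡ 0ℚ → p ≡ 0ℚ
  p+q≡0⇒p≡0 {p} {q} 0≤p 0≤q p+q≡0 =
    ≤-antisym (subst₂ _≤_ (+-identityʳ p) p+q≡0 (+-monoʳ-≤ p 0≤q)) 0≤p

  p+q≡0⇒q≡0 : ∀ {p q} → 0ℚ ≤ p → 0ℚ ≤ q → p + q ≡ 0ℚ → q ≡ 0ℚ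
  p+q≡0⇒q≡0 {p} {q} 0≤p 0≤q p+q≡0 = p+q≡0⇒p≡0 0≤q 0≤p (trans (+-comm q p) p+q≡0)

  p+q≡r⇒q≡r-p : ∀ {p q r} → p + q ≡ r → q ≡ r - p
  p+q≡r⇒q≡r-p {p} {q} p+q≡r =
    trans (solve 2 (λ p q → q := (p :+ q) :- p) refl p q) (cong (_- p) p+q≡r)

  p*q≡0⇒q≡0 : ∀ {p q} → 0ℚ < p → p * q ≡ 0ℚ → q ≡ 0ℚ
  p*q≡0⇒q≡0 {p} {q} 0<p p*q≡0 = begin
    q                  ≡⟨ sym (*-identityˡ q) ⟩
    1ℚ * q             ≡⟨ cong (_* q) (sym (*-inverseˡ p)) ⟩
    (1/ p) * p * q     ≡⟨ *-assoc (1/ p) p q ⟩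
    (1/ p) * (p * q)   ≡⟨ cong ((1/ p) *_) p*q≡0 ⟩
    (1/ p) * 0ℚ        ≡⟨ *-zeroʳ (1/ p) ⟩
    0ℚ                 ∎
    where
    open ≡-Reasoning
    instance _ = pos⇒nonZero p {{positive 0<p}}

  0≤bitℚ : ∀ b → 0ℚ ≤ bitℚ b
  0≤bitℚ true  = <⇒≤ (positive⁻¹ 1ℚ)
  0≤bitℚ false = ≤-refl

  bitℚ≤1 : ∀ b → bitℚ b ≤ 1ℚ
  bitℚ≤1 true  = ≤-refl
  bitℚ≤1 false = <⇒≤ (positive⁻¹ 1ℚ)

  convexCombination≡0⇒both≡0 : ∀ {c y z} → 0ℚ < c → c < 1ℚ → 0ℚ ≤ y → 0ℚ ≤ z →
    c * y + (1ℚ - c) * z ≡ 0ℚ → y ≡ 0ℚ × z ≡ 0ℚ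
  convexCombination≡0⇒both≡0 {c} {y} {z} 0<c c<1 0≤y 0≤z sum≡0 =
      p*q≡0⇒q≡0 0<c (p+q≡0⇒p≡0 0≤cy 0≤c'z sum≡0)
    , p*q≡0⇒q≡0 (p<q⇒0<q-p c<1) (p+q≡0⇒q≡0 0≤cy 0≤c'z sum≡0)
    where
    0≤cy : 0ℚ ≤ c * y
    0≤cy = 0≤p*q (<⇒≤ 0<c) 0≤y
    0≤c'z : 0ℚ ≤ (1ℚ - c) * z
    0≤c'z = 0≤p*q (<⇒≤ (p<q⇒0<q-p c<1)) 0≤z

  -- 1 is handled by reflecting [0,1] through 1 - _, which turns it into the case of 0.
  bitℚ-extreme-in-[0,1] : ∀ b {c y z} → 0ℚ < c → c < 1ℚ →
    0ℚ ≤ y → y ≤ 1ℚ → 0ℚ ≤ z → z ≤ 1ℚ →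
    bitℚ b ≡ c * y + (1ℚ - c) * z → y ≡ bitℚ b × z ≡ bitℚ b
  bitℚ-extreme-in-[0,1] false 0<c c<1 0≤y _ 0≤z _ b≡ =
    convexCombination≡0⇒both≡0 0<c c<1 0≤y 0≤z (sym b≡)
  bitℚ-extreme-in-[0,1] true {c} {y} {z} 0<c c<1 _ y≤1 _ z≤1 b≡ =
    let 1-y≡0 , 1-z≡0 = convexCombination≡0⇒both≡0 0<c c<1 (p≤q⇒0≤q-p y≤1) (p≤q⇒0≤q-p z≤1) reflected≡0
    in sym (p-q≡0⇒p≡q 1-y≡0) , sym (p-q≡0⇒p≡q 1-z≡0)
    where
    open ≡-Reasoning
    reflected≡0 : c * (1ℚ - y) + (1ℚ - c) * (1ℚ - z) ≡ 0ℚ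
    reflected≡0 = begin
      c * (1ℚ - y) + (1ℚ - c) * (1ℚ - z)
        ≡⟨ solve 3 (λ c y z → c :* (con 1ℚ :- y) :+ (con 1ℚ :- c) :* (con 1ℚ :- z)
                           := con 1ℚ :- (c :* y :+ (con 1ℚ :- c) :* z)) refl c y z ⟩
      1ℚ - (c * y + (1ℚ - c) * z)   ≡⟨ cong (λ s → 1ℚ - s) (sym b≡) ⟩
      1ℚ - 1ℚ                       ≡⟨ +-inverseʳ 1ℚ ⟩
      0ℚ                            ∎

-- InHull (IsTSSCPP n) and IsExtreme (IsTSSCPP n) unfold to InBTP n and IsVertex n.
module ConvexHull {I : Set} (P : (I → Bool) → Set) where
  open import Data.Rational using (ℚ; 0ℚ; 1ℚ; _+_; _*_; _-_; _≤_; _<_; 1/_; positive; nonNegative)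
  open import Data.Rational.Properties
  open import Data.Rational.Solver using (module +-*-Solver)
  open +-*-Solver using (solve; _:+_; _:*_; _:=_)

  Combination : Set
  Combination = List (ℚ × (I → Bool))

  weight : Combination → ℚ
  weight L = sumℚ (map (λ ct → proj₁ ct) L)

  point : Combination → I → ℚ
  point L p = sumℚ (map (λ ct → proj₁ ct * bitℚ (proj₂ ct p)) L)

  Admissible : Combination → Set
  Admissible L = ∀ {c t} → (c , t) ∈ L → (0ℚ ≤ c) × P t

  InHull : (I → ℚ) → Set
  InHull x = Σ Combination λ L → Admissible L × weight L ≡ 1ℚ × (∀ p → x p ≡ point L p)

  IsExtreme : (I → ℚ) → Set
  IsExtreme x = InHull x ×
    (∀ (y z : I → ℚ) (c : ℚ) → InHull y → InHull z → 0ℚ < c → c < 1ℚ →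
       (∀ p → x p ≡ (c * y p) + ((1ℚ - c) * z p)) →
       (∀ p → y p ≡ x p) × (∀ p → z p ≡ x p))

  admissible-tail : ∀ {ct L} → Admissible (ct ∷ L) → Admissible L
  admissible-tail adm ct∈L = adm (there ct∈L)

  weight-nonneg : ∀ L → Admissible L → 0ℚ ≤ weight L
  weight-nonneg []            _   = ≤-refl
  weight-nonneg ((c , t) ∷ L) adm =
    0≤p+q (proj₁ (adm (here refl))) (weight-nonneg L (admissible-tail adm))

  point-nonneg : ∀ L → Admissible L → ∀ p → 0ℚ ≤ point L p
  point-nonneg []            _   p = ≤-refl
  point-nonneg ((c , t) ∷ L) adm p =
    0≤p+q (0≤p*q (proj₁ (adm (here refl))) (0≤bitℚ (t p))) (point-nonneg L (admissible-tail adm) p)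

  point≤weight : ∀ L → Admissible L → ∀ p → point L p ≤ weight L
  point≤weight []            _   p = ≤-refl
  point≤weight ((c , t) ∷ L) adm p = +-mono-≤ c*b≤c (point≤weight L (admissible-tail adm) p)
    where
    c*b≤c : c * bitℚ (t p) ≤ c
    c*b≤c = subst (c * bitℚ (t p) ≤_) (*-identityʳ c)
      (*-monoˡ-≤-nonNeg c {{nonNegative (proj₁ (adm (here refl)))}} (bitℚ≤1 (t p)))

  inHull⇒∈[0,1] : ∀ {x} → InHull x → ∀ p → 0ℚ ≤ x p × x p ≤ 1ℚ
  inHull⇒∈[0,1] (L , adm , weight≡1 , x≡) p =
      subst (0ℚ ≤_) (sym (x≡ p)) (point-nonneg L adm p)
    , subst₂ _≤_ (sym (x≡ p)) weight≡1 (point≤weight L adm p)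

  member⇒inHull : ∀ {x t} → P t → (∀ p → x p ≡ bitℚ (t p)) → InHull x
  member⇒inHull {x} {t} Pt x≡t = ((1ℚ , t) ∷ []) , adm , refl , point≡
    where
    adm : Admissible ((1ℚ , t) ∷ [])
    adm (here refl) = <⇒≤ (positive⁻¹ 1ℚ) , Pt

    point≡ : ∀ p → x p ≡ point ((1ℚ , t) ∷ []) p
    point≡ p = trans (x≡t p) (sym (trans (+-identityʳ _) (*-identityˡ _)))

  member⇒extreme : ∀ {x t} → P t → (∀ p → x p ≡ bitℚ (t p)) → IsExtreme x
  member⇒extreme {x} {t} Pt x≡t = member⇒inHull Pt x≡t , extreme
    where
    extreme : ∀ y z c → InHull y → InHull z → 0ℚ < c → c < 1ℚ →
      (∀ p → x p ≡ (c * y p) + ((1ℚ - c) * z p)) → (∀ p → y p ≡ x p) × (∀ p → z p ≡ x p)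
    extreme y z c y∈ z∈ 0<c c<1 x≡yz = (λ p → proj₁ (at p)) , (λ p → proj₂ (at p))
      where
      at : ∀ p → y p ≡ x p × z p ≡ x p
      at p =
        let 0≤y , y≤1 = inHull⇒∈[0,1] y∈ p
            0≤z , z≤1 = inHull⇒∈[0,1] z∈ p
            y≡ , z≡ = bitℚ-extreme-in-[0,1] (t p) 0<c c<1 0≤y y≤1 0≤z z≤1
                        (trans (sym (x≡t p)) (x≡yz p))
        in trans y≡ (sym (x≡t p)) , trans z≡ (sym (x≡t p))

  scale : ℚ → Combination → Combination
  scale k = map (λ ct → k * proj₁ ct , proj₂ ct)

  weight-scale : ∀ k L → weight (scale k L) ≡ k * weight L
  weight-scale k []            = sym (*-zeroʳ k)
  weight-scale k ((c , t) ∷ L) =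
    trans (cong (k * c +_) (weight-scale k L)) (sym (*-distribˡ-+ k c (weight L)))

  point-scale : ∀ k L p → point (scale k L) p ≡ k * point L p
  point-scale k []            p = sym (*-zeroʳ k)
  point-scale k ((c , t) ∷ L) p =
    trans (cong (k * c * bitℚ (t p) +_) (point-scale k L p))
      (solve 4 (λ k c b s → k :* c :* b :+ k :* s := k :* (c :* b :+ s)) refl
         k c (bitℚ (t p)) (point L p))

  admissible-scale : ∀ {k} L → 0ℚ ≤ k → Admissible L → Admissible (scale k L)
  admissible-scale {k} L 0≤k adm kct∈ with ∈-map⁻ (λ ct → k * proj₁ ct , proj₂ ct) kct∈
  ... | _ , ct∈L , refl = 0≤p*q 0≤k (proj₁ (adm ct∈L)) , proj₂ (adm ct∈L)

  normalise : ∀ L {d} → 0ℚ < d → Admissible L → weight L ≡ d →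
    Σ Combination λ L′ → Admissible L′ × weight L′ ≡ 1ℚ × (∀ p → point L p ≡ d * point L′ p)
  normalise L {d} 0<d adm weight≡d =
    scale (1/ d) L ,
    admissible-scale L (<⇒≤ (positive⁻¹ (1/ d) {{1/pos⇒pos d {{positive 0<d}}}})) adm ,
    trans (weight-scale (1/ d) L) (trans (cong ((1/ d) *_) weight≡d) (*-inverseˡ d)) ,
    point≡
    where
    instance _ = pos⇒nonZero d {{positive 0<d}}
    open ≡-Reasoning
    point≡ : ∀ p → point L p ≡ d * point (scale (1/ d) L) p
    point≡ p = begin
      point L p                    ≡⟨ sym (*-identityˡ (point L p)) ⟩
      1ℚ * point L p               ≡⟨ cong (_* point L p) (sym (*-inverseʳ d)) ⟩
      d * (1/ d) * point L p       ≡⟨ *-assoc d (1/ d) (point L p) ⟩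
      d * ((1/ d) * point L p)     ≡⟨ cong (d *_) (sym (point-scale (1/ d) L p)) ⟩
      d * point (scale (1/ d) L) p ∎

  weight≡0⇒point≡0 : ∀ L → Admissible L → weight L ≡ 0ℚ → ∀ p → point L p ≡ 0ℚ
  weight≡0⇒point≡0 L adm weight≡0 p =
    ≤-antisym (subst (point L p ≤_) weight≡0 (point≤weight L adm p)) (point-nonneg L adm p)

  split-head : ∀ {c t R} → c < 1ℚ → Admissible R → c + weight R ≡ 1ℚ →
    Σ (I → ℚ) λ z → InHull z × (∀ p → point ((c , t) ∷ R) p ≡ c * bitℚ (t p) + (1ℚ - c) * z p)
  split-head {c} {t} {R} c<1 admR weight≡1 =
    let R′ , admR′ , weightR′≡1 , pointR≡ = normalise R (p<q⇒0<q-p c<1) admR (p+q≡r⇒q≡r-p {c} weight≡1)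
    in point R′ , (R′ , admR′ , weightR′≡1 , λ _ → refl) , λ p → cong (c * bitℚ (t p) +_) (pointR≡ p)

  extreme⇒member : ∀ {x} → IsExtreme x → Σ (I → Bool) λ t → P t × (∀ p → x p ≡ bitℚ (t p))
  extreme⇒member {x} ((L , adm , weight≡1 , x≡) , extreme) = search L adm weight≡1 x≡
    where
    search : ∀ L → Admissible L → weight L ≡ 1ℚ → (∀ p → x p ≡ point L p) →
      Σ (I → Bool) λ t → P t × (∀ p → x p ≡ bitℚ (t p))
    search [] _ () _
    search ((c , t) ∷ R) adm weight≡1 x≡ with <-cmp c 0ℚ
    ... | tri< c<0 _ _  = ⊥-elim (<-irrefl refl (<-≤-trans c<0 (proj₁ (adm (here refl)))))
    ... | tri≈ _ refl _ =
      search R (admissible-tail adm) (trans (sym (+-identityˡ (weight R))) weight≡1) λ p →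
        trans (x≡ p) (trans (cong (_+ point R p) (*-zeroˡ (bitℚ (t p)))) (+-identityˡ (point R p)))
    ... | tri> _ _ 0<c with <-cmp c 1ℚ
    ...   | tri> _ _ 1<c =
      ⊥-elim (<-irrefl refl (subst (1ℚ <_) weight≡1 (+-mono-<-≤ 1<c (weight-nonneg R (admissible-tail adm)))))
    ...   | tri≈ _ refl _ = t , proj₂ (adm (here refl)) , λ p →
      trans (x≡ p) (trans (cong (1ℚ * bitℚ (t p) +_) (pointR≡0 p)) (trans (+-identityʳ _) (*-identityˡ _)))
      where
      pointR≡0 : ∀ p → point R p ≡ 0ℚ
      pointR≡0 = weight≡0⇒point≡0 R (admissible-tail adm) (trans (p+q≡r⇒q≡r-p {1ℚ} weight≡1) (+-inverseʳ 1ℚ))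
    ...   | tri< c<1 _ _ =
      let Pt = proj₂ (adm (here refl))
          z , z∈ , point≡ = split-head c<1 (admissible-tail adm) weight≡1
          t≡x , _ = extreme (λ p → bitℚ (t p)) z c (member⇒inHull Pt (λ _ → refl)) z∈ 0<c c<1
                      (λ p → trans (x≡ p) (point≡ p))
      in t , Pt , λ p → sym (t≡x p)

open import Data.Nat using (ℕ; _≤_)

theorem5p5 : (n : ℕ) → 1 ≤ n → (x : Point n) →
    (IsVertex n x → Σ (Triangle n) λ t → IsTSSCPP n t × (∀ p → x p ≡ embed n t p))
    × ((Σ (Triangle n) λ t → IsTSSCPP n t × (∀ p → x p ≡ embed n t p)) → IsVertex n x)
theorem5p5 n _ x = extreme⇒member , λ (t , tsscpp , x≡t) → member⇒extreme tsscpp x≡t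
  where open ConvexHull (IsTSSCPP n)
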